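{- If a digraph $D=(V,E)$ satisfies $|E|>|V|\log_2|V|$ and $D$ is not transitive, then $D$ does not have the tournament forcing property.
   Context: All digraphs are oriented graphs (no loops, no antiparallel edges). A digraph $D=(V,E)$ is transitive if for all $(x,y),(y,z)\in E$, whenever there is an edge on $\{x,z\}$ it is $(x,z)\in E$. A tournament is an orientation of a complete graph without loops. $t_D(T)=h_D(T)/v(T)^{v(D)}$ where $h_D(T)$ is the number of maps $\phi:V(D)\to V(T)$ sending each edge $(x,y)$ of $D$ to an edge $(\phi(x),\phi(y))$ of $T$. For $A,B\subseteq V(T)$, $e(A,B)$ counts pairs $(a,b)\in A\times B$ with $(a,b)\in E(T)$. A tournament $T$ on $n$ vertices has $\epsilon$-quasirandom direction if $e(A,B)-e(B,A)\le\epsilon n^2$ for all $A,B\subseteq V(T)$; a sequence $(T_n)$, $T_n$ on $n$ vertices, has quasirandom direction if $T_n$ has $\epsilon_n$-quasirandom direction with $\epsilon_n\to0$. $D$ has the tournament forcing property if a sequence $(T_n)$ has quasirandom direction if and only if $t_D(T_n)=2^{ -e(D)}+o(1)$. -}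

module Defs where

open import Data.Bool using (Bool; true; false; _∧_; if_then_else_)
open import Data.Nat as ℕ using (ℕ; zero; suc; _^_; _≤_; _<_)
open import Data.Nat.Properties using (m^n≢0)
open import Data.Integer as ℤ using (+_)
open import Data.Rational as ℚ using (ℚ; 0ℚ; _/_)
open import Data.Fin using (Fin)
open import Data.Vec using (Vec; lookup)
open import Data.Vec.Functional using () renaming (_∷_ to _∷ᶠ_)
open import Data.List using (List; []; _∷_; map; concatMap; allFin; filterᵇ; length)
open import Data.Bool.ListAction using (and)
open import Data.Product using (Σ; ∃; _×_; _,_)
open import Data.Sum using (_⊎_)
open import Relation.Binary.PropositionalEquality using (_≡_; _≢_)

record Digraph : Set where
  field
    v        : ℕ
    E        : Fin v → Fin v → Bool
    loopless : ∀ x → E x x ≡ false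
    oriented : ∀ x y → E x y ≡ true → E y x ≡ false
open Digraph public

record Tournament (n : ℕ) : Set where
  field
    adj      : Fin n → Fin n → Bool
    loopless : ∀ x → adj x x ≡ false
    oriented : ∀ x y → adj x y ≡ true → adj y x ≡ false
    complete : ∀ x y → x ≢ y → (adj x y ≡ true) ⊎ (adj y x ≡ true)
open Tournament public
  hiding (loopless; oriented)

count : {A : Set} → (A → Bool) → List A → ℕ
count p xs = length (filterᵇ p xs)

allPairs : (n : ℕ) → List (Fin n × Fin n)
allPairs n = concatMap (λ x → map (λ y → (x , y)) (allFin n)) (allFin n)

numEdges : Digraph → ℕ
numEdges D = count (λ { (x , y) → E D x y }) (allPairs (v D))

Transitive : Digraph → Set
Transitive D = ∀ x y z → E D x y ≡ true → E D y z ≡ true →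
  (E D x z ≡ true ⊎ E D z x ≡ true) → E D x z ≡ true

allMaps : (k n : ℕ) → List (Fin k → Fin n)
allMaps zero    n = (λ ()) ∷ []
allMaps (suc k) n = concatMap (λ f → map (λ i → i ∷ᶠ f) (allFin n)) (allMaps k n)

isHom : (D : Digraph) {n : ℕ} → Tournament n → (Fin (v D) → Fin n) → Bool
isHom D T φ = and (map (λ { (x , y) → if E D x y then adj T (φ x) (φ y) else true }) (allPairs (v D)))

homCount : (D : Digraph) {n : ℕ} → Tournament n → ℕ
homCount D {n} T = count (isHom D T) (allMaps (v D) n)

-- t_D(T) = h_D(T) / n^{v(D)}  (set to 0 for the empty tournament, irrelevant asymptotically)
homDensity : (D : Digraph) {n : ℕ} → Tournament n → ℚ
homDensity D {zero}  T = 0ℚ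
homDensity D {suc m} T = _/_ (+ homCount D T) (suc m ^ v D) {{m^n≢0 (suc m) (v D)}}

twoPowNeg : ℕ → ℚ
twoPowNeg e = _/_ (+ 1) (2 ^ e) {{m^n≢0 2 e}}

Subset : ℕ → Set
Subset n = Vec Bool n

eAB : {n : ℕ} → Tournament n → Subset n → Subset n → ℕ
eAB {n} T A B = count (λ { (a , b) → lookup A a ∧ lookup B b ∧ adj T a b }) (allPairs n)

QuasirandomDirection : {n : ℕ} → ℚ → Tournament n → Set
QuasirandomDirection {n} ε T = ∀ (A B : Subset n) →
  (+ eAB T A B / 1) ℚ.- (+ eAB T B A / 1) ℚ.≤ ε ℚ.* (+ (n ℕ.* n) / 1)

TendsTo : (ℕ → ℚ) → ℚ → Set
TendsTo x L = ∀ δ → 0ℚ ℚ.< δ → ∃ λ N → ∀ n → N ≤ n → ℚ.∣ x n ℚ.- L ∣ ℚ.≤ δ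

TournamentSeq : Set
TournamentSeq = (n : ℕ) → Tournament n

HasQuasirandomDirection : TournamentSeq → Set
HasQuasirandomDirection T = Σ (ℕ → ℚ) λ ε →
  (∀ n → QuasirandomDirection (ε n) (T n)) × TendsTo ε 0ℚ

TournamentForcing : Digraph → Set
TournamentForcing D = ∀ (T : TournamentSeq) →
  (HasQuasirandomDirection T → TendsTo (λ n → homDensity D (T n)) (twoPowNeg (numEdges D)))
  × (TendsTo (λ n → homDensity D (T n)) (twoPowNeg (numEdges D)) → HasQuasirandomDirection T)

-- A non-transitive oriented graph D contains a directed triangle, so D has no homomorphism
-- into a transitive tournament. Blow D up by replacing each vertex with a block of n / V
-- vertices (V = v(D)), orienting the non-adjacent pairs of D and the pairs inside a block by
-- the index order: the maps sending each vertex of D into its own block already give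
-- t_D ≥ (n / V)^V / n^V ≥ 2^-e(D), because V^V < 2^e(D). Reorienting the pairs among the
-- first k vertices by the index order, for k = 0, 1, ..., n, ends at the transitive tournament
-- (t_D = 0) and changes h_D by at most V n^(V-1) at each step, so some intermediate tournament
-- has t_D within V / n of 2^-e(D). All of them send every edge between the blocks of an
-- ascending edge of D forward, so none has quasirandom direction.

module Submission where

open import Defs
open import Data.Nat using (_^_; _<_)
open import Relation.Nullary using (¬_)

import Algebra.Properties.CommutativeSemigroup as CommutativeSemigroupProperties
open import Data.Bool using (Bool; true; false; _∧_; _∨_; not; if_then_else_)
import Data.Bool as Bool
open import Data.Bool.Properties
  using (∨-comm; ∧-comm; not-injective; ∧-conicalˡ; ∧-conicalʳ; ∨-conicalˡ; ∨-conicalʳ; T-≡)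
open import Data.Empty using (⊥-elim)
open import Data.Fin as Fin using (Fin; toℕ)
import Data.Fin.Properties as FinP
import Data.Integer as ℤ
import Data.Integer.Properties as ℤP
open import Data.List using (List; []; _∷_; _++_; map; concatMap; allFin; tabulate; length; filterᵇ)
open import Data.List.Membership.Propositional using (_∈_)
open import Data.List.Membership.Propositional.Properties using (∈-concatMap⁺; ∈-map⁺; ∈-allFin)
open import Data.List.Properties using (map-cong; map-tabulate; length-tabulate; length-++; filter-++)
import Data.List.Relation.Unary.All as All
open import Data.List.Relation.Unary.All.Properties using (all⁺; all⁻)
import Data.List.Relation.Unary.Any as Any
open import Data.Nat as ℕ using (ℕ; zero; suc; _+_; _*_; _∸_; _≤_; _⊓_; _/_; _%_; z≤n; s≤s)
open import Data.Nat.DivMod using (m<n*o⇒m/o<n; m*n/n≡m; /-monoˡ-≤; m/n*n≤m; m≡m%n+[m/n]*n; m%n<n)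
open import Data.Nat.ListAction using (sum)
open import Data.Nat.Properties
open CommutativeSemigroupProperties +-commutativeSemigroup using () renaming (interchange to +-interchange)
open CommutativeSemigroupProperties *-commutativeSemigroup
  using (xy∙z≈y∙xz; x∙yz≈y∙xz; xy∙z≈zy∙x) renaming (interchange to *-interchange)
open import Data.Nat.Tactic.RingSolver using (solve-∀)
open import Data.Product using (Σ; ∃; _×_; _,_; proj₁; proj₂)
import Data.Rational as ℚ
import Data.Rational.Properties as ℚP
import Data.Rational.Unnormalised as ℚᵘ
import Data.Rational.Unnormalised.Properties as ℚᵘP
open import Data.Sum using (_⊎_; inj₁; inj₂)
open import Data.Vec as Vec using (lookup)
open import Data.Vec.Functional using () renaming (_∷_ to _∷ᶠ_)
import Data.Vec.Properties as VecP
open import Function using (_∘_; const; id)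
open import Function.Bundles using (module Equivalence)
open import Relation.Binary.Definitions using (tri<; tri≈; tri>)
open import Relation.Binary.PropositionalEquality
open import Relation.Nullary.Decidable using (Dec; yes; no; does; dec-true; dec-false)
open import Relation.Nullary.Negation using (contradiction)

private variable
  A B : Set

does-true⇒ : {P : Set} (P? : Dec P) → does P? ≡ true → P
does-true⇒ (yes p) _ = p

does-false⇒ : {P : Set} (P? : Dec P) → does P? ≡ false → ¬ P
does-false⇒ (no ¬p) _ = ¬p

∨-true⁻ : ∀ a b → a ∨ b ≡ true → a ≡ true ⊎ b ≡ true
∨-true⁻ true  b _ = inj₁ refl
∨-true⁻ false b h = inj₂ h

indicator : Bool → ℕ
indicator true  = 1
indicator false = 0

count-∷ : (p : A → Bool) (x : A) (xs : List A) → count p (x ∷ xs) ≡ indicator (p x) + count p xs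
count-∷ p x xs with p x
... | true  = refl
... | false = refl

count-++ : (p : A → Bool) (xs ys : List A) → count p (xs ++ ys) ≡ count p xs + count p ys
count-++ p xs ys = trans (cong length (filter-++ (Bool.T? ∘ p) xs ys)) (length-++ (filterᵇ p xs))

count-concatMap : (p : B → Bool) (f : A → List B) (xs : List A) →
  count p (concatMap f xs) ≡ sum (map (count p ∘ f) xs)
count-concatMap p f []       = refl
count-concatMap p f (x ∷ xs) =
  trans (count-++ p (f x) (concatMap f xs)) (cong (count p (f x) +_) (count-concatMap p f xs))

count-map : (p : B → Bool) (g : A → B) (xs : List A) → count p (map g xs) ≡ count (p ∘ g) xs
count-map p g []       = refl
count-map p g (x ∷ xs) with p (g x)
... | true  = cong suc (count-map p g xs)
... | false = count-map p g xs

count-cong : {p q : A → Bool} → (∀ x → p x ≡ q x) → (xs : List A) → count p xs ≡ count q xs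
count-cong {p = p} {q} p≗q []       = refl
count-cong {p = p} {q} p≗q (x ∷ xs) = begin
  count p (x ∷ xs)                ≡⟨ count-∷ p x xs ⟩
  indicator (p x) + count p xs    ≡⟨ cong₂ _+_ (cong indicator (p≗q x)) (count-cong p≗q xs) ⟩
  indicator (q x) + count q xs    ≡⟨ count-∷ q x xs ⟨
  count q (x ∷ xs)                ∎
  where open ≡-Reasoning

indicator-mono : ∀ {a b} → (a ≡ true → b ≡ true) → indicator a ≤ indicator b
indicator-mono {true}  a⇒b rewrite a⇒b refl = ≤-refl
indicator-mono {false} a⇒b = z≤n

indicator-∨ : ∀ {a b c} → (a ≡ true → b ≡ true ⊎ c ≡ true) → indicator a ≤ indicator b + indicator c
indicator-∨ {false} a⇒b∨c = z≤n
indicator-∨ {true} {b} a⇒b∨c with a⇒b∨c refl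
... | inj₁ refl = s≤s z≤n
... | inj₂ refl = m≤n+m 1 (indicator b)

count-mono : (p q : A → Bool) → (∀ x → p x ≡ true → q x ≡ true) →
  (xs : List A) → count p xs ≤ count q xs
count-mono p q p⊆q []       = z≤n
count-mono p q p⊆q (x ∷ xs) rewrite count-∷ p x xs | count-∷ q x xs =
  +-mono-≤ (indicator-mono (p⊆q x)) (count-mono p q p⊆q xs)

count-∨-≤ : (p q r : A → Bool) → (∀ x → p x ≡ true → q x ≡ true ⊎ r x ≡ true) →
  (xs : List A) → count p xs ≤ count q xs + count r xs
count-∨-≤ p q r p⊆q∪r []       = z≤n
count-∨-≤ p q r p⊆q∪r (x ∷ xs)
  rewrite count-∷ p x xs | count-∷ q x xs | count-∷ r x xs = begin
  indicator (p x) + count p xs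
    ≤⟨ +-mono-≤ (indicator-∨ (p⊆q∪r x)) (count-∨-≤ p q r p⊆q∪r xs) ⟩
  (indicator (q x) + indicator (r x)) + (count q xs + count r xs)
    ≡⟨ +-interchange (indicator (q x)) _ _ _ ⟩
  (indicator (q x) + count q xs) + (indicator (r x) + count r xs) ∎
  where open ≤-Reasoning

count-none : (p : A → Bool) → (∀ x → p x ≡ false) → (xs : List A) → count p xs ≡ 0
count-none p ¬p []       = refl
count-none p ¬p (x ∷ xs) rewrite count-∷ p x xs | ¬p x = count-none p ¬p xs

count-true : (xs : List A) → count (const true) xs ≡ length xs
count-true []       = refl
count-true (_ ∷ xs) = cong suc (count-true xs)

count-const : (b : Bool) (xs : List A) → count (const b) xs ≡ indicator b * length xs
count-const true  xs = trans (count-true xs) (sym (+-identityʳ (length xs)))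
count-const false xs = count-none (const false) (λ _ → refl) xs

count-∧ˡ : (b : Bool) (q : A → Bool) (xs : List A) → count (λ x → b ∧ q x) xs ≡ indicator b * count q xs
count-∧ˡ true  q xs = sym (+-identityʳ (count q xs))
count-∧ˡ false q xs = count-none (const false) (λ _ → refl) xs

count-∧ʳ : (q : A → Bool) (b : Bool) (xs : List A) → count (λ x → q x ∧ b) xs ≡ indicator b * count q xs
count-∧ʳ q b xs = trans (count-cong (λ x → ∧-comm (q x) b) xs) (count-∧ˡ b q xs)

sum-map-const : (c : ℕ) (xs : List A) → sum (map (const c) xs) ≡ c * length xs
sum-map-const c []       = sym (*-zeroʳ c)
sum-map-const c (x ∷ xs) = trans (cong (c +_) (sum-map-const c xs)) (sym (*-suc c (length xs)))

sum-map-indicator-* : (p : A → Bool) (c : ℕ) (xs : List A) →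
  sum (map (λ x → indicator (p x) * c) xs) ≡ count p xs * c
sum-map-indicator-* p c []       = refl
sum-map-indicator-* p c (x ∷ xs) = begin
  indicator (p x) * c + sum (map (λ x → indicator (p x) * c) xs)
    ≡⟨ cong (indicator (p x) * c +_) (sum-map-indicator-* p c xs) ⟩
  indicator (p x) * c + count p xs * c  ≡⟨ *-distribʳ-+ c (indicator (p x)) (count p xs) ⟨
  (indicator (p x) + count p xs) * c    ≡⟨ cong (_* c) (count-∷ p x xs) ⟨
  count p (x ∷ xs) * c                  ∎
  where open ≡-Reasoning

length-allFin : (n : ℕ) → length (allFin n) ≡ n
length-allFin n = length-tabulate id

count-tabulate : {n : ℕ} (p : A → Bool) (f : Fin n → A) → count p (tabulate f) ≡ count (p ∘ f) (allFin n)
count-tabulate p f = trans (cong (count p) (sym (map-tabulate id f))) (count-map p f (allFin _))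

count-tabulate-interval-≥ : {n : ℕ} (p : A → Bool) (f : Fin n → A) (lo len : ℕ) → lo + len ≤ n →
  (∀ i → lo ≤ toℕ i → toℕ i ℕ.< lo + len → p (f i) ≡ true) → len ≤ count p (tabulate f)
count-tabulate-interval-≥ p f lo zero _ _ = z≤n
count-tabulate-interval-≥ {n = suc n} p f zero (suc len) (s≤s len≤n) inside
  rewrite count-∷ p (f Fin.zero) (tabulate (f ∘ Fin.suc)) | inside Fin.zero z≤n (s≤s z≤n) =
  s≤s (count-tabulate-interval-≥ p (f ∘ Fin.suc) zero len len≤n (λ i _ i<len → inside (Fin.suc i) z≤n (s≤s i<len)))
count-tabulate-interval-≥ {n = suc n} p f (suc lo) (suc len) (s≤s lo+len≤n) inside
  rewrite count-∷ p (f Fin.zero) (tabulate (f ∘ Fin.suc)) =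
  m≤n⇒m≤o+n (indicator (p (f Fin.zero)))
    (count-tabulate-interval-≥ p (f ∘ Fin.suc) lo (suc len) lo+len≤n (λ i lo≤i i<hi → inside (Fin.suc i) (s≤s lo≤i) (s≤s i<hi)))

count-toℕ-≡-≤1 : (n k : ℕ) → count (λ c → does (toℕ c ℕ.≟ k)) (allFin n) ≤ 1
count-toℕ-≡-≤1 zero    k       = z≤n
count-toℕ-≡-≤1 (suc n) zero    =
  ≤-reflexive (cong suc (trans (count-tabulate {n = n} (λ c → does (toℕ c ℕ.≟ 0)) Fin.suc)
                               (count-none _ (λ _ → refl) (allFin n))))
count-toℕ-≡-≤1 (suc n) (suc k) =
  ≤-trans (≤-reflexive (count-tabulate {n = n} (λ c → does (toℕ c ℕ.≟ suc k)) Fin.suc))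
          (count-toℕ-≡-≤1 n k)

anyᶠ : {k : ℕ} → (Fin k → Bool) → Bool
anyᶠ {zero}  Q = false
anyᶠ {suc k} Q = Q Fin.zero ∨ anyᶠ (Q ∘ Fin.suc)

anyᶠ-false : {k : ℕ} (Q : Fin k → Bool) → anyᶠ Q ≡ false → ∀ x → Q x ≡ false
anyᶠ-false Q none Fin.zero    = ∨-conicalˡ _ _ none
anyᶠ-false Q none (Fin.suc x) = anyᶠ-false (Q ∘ Fin.suc) (∨-conicalʳ _ _ none) x

count-anyᶠ-≤ : (k : ℕ) (Q : Fin k → A → Bool) (xs : List A) (m N : ℕ) →
  (∀ x → count (Q x) xs * m ≤ N) → count (λ a → anyᶠ (λ x → Q x a)) xs * m ≤ k * N
count-anyᶠ-≤ zero    Q xs m N _ = ≤-reflexive (cong (_* m) (count-none _ (λ _ → refl) xs))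
count-anyᶠ-≤ (suc k) Q xs m N small = begin
  count (λ a → anyᶠ (λ x → Q x a)) xs * m
    ≤⟨ *-monoˡ-≤ m (count-∨-≤ _ (Q Fin.zero) _ (λ a → ∨-true⁻ _ _) xs) ⟩
  (count (Q Fin.zero) xs + count (λ a → anyᶠ (λ x → Q (Fin.suc x) a)) xs) * m
    ≡⟨ *-distribʳ-+ m (count (Q Fin.zero) xs) _ ⟩
  count (Q Fin.zero) xs * m + count (λ a → anyᶠ (λ x → Q (Fin.suc x) a)) xs * m
    ≤⟨ +-mono-≤ (small Fin.zero) (count-anyᶠ-≤ k (Q ∘ Fin.suc) xs m N (small ∘ Fin.suc)) ⟩
  N + k * N ∎
  where open ≤-Reasoning

count-allPairs-∧ : (n : ℕ) (P Q : Fin n → Bool) →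
  count (λ { (a , b) → P a ∧ Q b }) (allPairs n) ≡ count P (allFin n) * count Q (allFin n)
count-allPairs-∧ n P Q = begin
  count (λ { (a , b) → P a ∧ Q b }) (allPairs n)
    ≡⟨ count-concatMap _ (λ a → map (a ,_) (allFin n)) (allFin n) ⟩
  sum (map (λ a → count (λ { (a , b) → P a ∧ Q b }) (map (a ,_) (allFin n))) (allFin n))
    ≡⟨ cong sum (map-cong (λ a → trans (count-map _ (a ,_) (allFin n)) (count-∧ˡ (P a) Q (allFin n))) (allFin n)) ⟩
  sum (map (λ a → indicator (P a) * count Q (allFin n)) (allFin n))
    ≡⟨ sum-map-indicator-* P _ (allFin n) ⟩
  count P (allFin n) * count Q (allFin n) ∎
  where open ≡-Reasoning

count-allMaps-suc : (k n : ℕ) (p : (Fin (suc k) → Fin n) → Bool) →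
  count p (allMaps (suc k) n) ≡ sum (map (λ f → count (λ i → p (i ∷ᶠ f)) (allFin n)) (allMaps k n))
count-allMaps-suc k n p = trans (count-concatMap p _ (allMaps k n))
  (cong sum (map-cong (λ f → count-map p (_∷ᶠ f) (allFin n)) (allMaps k n)))

length-allMaps : (k n : ℕ) → length (allMaps k n) ≡ n ^ k
length-allMaps zero    n = refl
length-allMaps (suc k) n = begin
  length (allMaps (suc k) n)                  ≡⟨ count-true (allMaps (suc k) n) ⟨
  count (const true) (allMaps (suc k) n)      ≡⟨ count-allMaps-suc k n (const true) ⟩
  sum (map (λ _ → count (const true) (allFin n)) (allMaps k n))
    ≡⟨ sum-map-const (count (const true) (allFin n)) (allMaps k n) ⟩
  count (const true) (allFin n) * length (allMaps k n)
    ≡⟨ cong₂ _*_ (trans (count-true (allFin n)) (length-allFin n)) (length-allMaps k n) ⟩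
  n * n ^ k                                   ∎
  where open ≡-Reasoning

count-allMaps-at : (k n : ℕ) (x : Fin k) (Q : Fin n → Bool) →
  count (λ φ → Q (φ x)) (allMaps k n) * n ≡ n ^ k * count Q (allFin n)
count-allMaps-at (suc k) n Fin.zero Q = begin
  count (λ φ → Q (φ Fin.zero)) (allMaps (suc k) n) * n
    ≡⟨ cong (_* n) (count-allMaps-suc k n _) ⟩
  sum (map (const (count Q (allFin n))) (allMaps k n)) * n
    ≡⟨ cong (_* n) (sum-map-const (count Q (allFin n)) (allMaps k n)) ⟩
  count Q (allFin n) * length (allMaps k n) * n
    ≡⟨ cong (λ m → count Q (allFin n) * m * n) (length-allMaps k n) ⟩
  count Q (allFin n) * n ^ k * n  ≡⟨ xy∙z≈zy∙x (count Q (allFin n)) (n ^ k) n ⟩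
  n * n ^ k * count Q (allFin n)  ∎
  where open ≡-Reasoning
count-allMaps-at (suc k) n (Fin.suc x) Q = begin
  count (λ φ → Q (φ (Fin.suc x))) (allMaps (suc k) n) * n
    ≡⟨ cong (_* n) (count-allMaps-suc k n _) ⟩
  sum (map (λ f → count (const (Q (f x))) (allFin n)) (allMaps k n)) * n
    ≡⟨ cong (λ s → sum s * n) (map-cong (λ f → count-const-allFin (Q (f x))) (allMaps k n)) ⟩
  sum (map (λ f → indicator (Q (f x)) * n) (allMaps k n)) * n
    ≡⟨ cong (_* n) (sum-map-indicator-* (λ f → Q (f x)) n (allMaps k n)) ⟩
  count (λ f → Q (f x)) (allMaps k n) * n * n
    ≡⟨ cong (_* n) (*-comm _ n) ⟩
  n * count (λ f → Q (f x)) (allMaps k n) * n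
    ≡⟨ *-assoc n _ n ⟩
  n * (count (λ f → Q (f x)) (allMaps k n) * n)
    ≡⟨ cong (n *_) (count-allMaps-at k n x Q) ⟩
  n * (n ^ k * count Q (allFin n))  ≡⟨ *-assoc n (n ^ k) _ ⟨
  n * n ^ k * count Q (allFin n)    ∎
  where
  open ≡-Reasoning
  count-const-allFin : (b : Bool) → count (const b) (allFin n) ≡ indicator b * n
  count-const-allFin b = trans (count-const b (allFin n)) (cong (indicator b *_) (length-allFin n))

pointwise : {k n : ℕ} → (Fin k → Fin n → Bool) → (Fin k → Fin n) → Bool
pointwise {zero}  P φ = true
pointwise {suc k} P φ = P Fin.zero (φ Fin.zero) ∧ pointwise (P ∘ Fin.suc) (φ ∘ Fin.suc)

pointwise-sound : {k n : ℕ} (P : Fin k → Fin n → Bool) (φ : Fin k → Fin n) →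
  pointwise P φ ≡ true → ∀ x → P x (φ x) ≡ true
pointwise-sound P φ h Fin.zero    = ∧-conicalˡ _ _ h
pointwise-sound P φ h (Fin.suc x) = pointwise-sound (P ∘ Fin.suc) (φ ∘ Fin.suc) (∧-conicalʳ _ _ h) x

count-pointwise-≥ : (k n a : ℕ) (P : Fin k → Fin n → Bool) → (∀ y → a ≤ count (P y) (allFin n)) →
  a ^ k ≤ count (pointwise P) (allMaps k n)
count-pointwise-≥ zero    n a P large = ≤-refl
count-pointwise-≥ (suc k) n a P large = begin
  a * a ^ k                     ≡⟨ *-comm a (a ^ k) ⟩
  a ^ k * a
    ≤⟨ *-mono-≤ (count-pointwise-≥ k n a (P ∘ Fin.suc) (large ∘ Fin.suc)) (large Fin.zero) ⟩
  count (pointwise (P ∘ Fin.suc)) (allMaps k n) * count (P Fin.zero) (allFin n)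
    ≡⟨ sum-map-indicator-* (pointwise (P ∘ Fin.suc)) _ (allMaps k n) ⟨
  sum (map (λ f → indicator (pointwise (P ∘ Fin.suc) f) * count (P Fin.zero) (allFin n)) (allMaps k n))
    ≡⟨ cong sum (map-cong (λ f → count-∧ʳ (P Fin.zero) _ (allFin n)) (allMaps k n)) ⟨
  sum (map (λ f → count (λ i → P Fin.zero i ∧ pointwise (P ∘ Fin.suc) f) (allFin n)) (allMaps k n))
    ≡⟨ count-allMaps-suc k n (pointwise P) ⟨
  count (pointwise P) (allMaps (suc k) n)  ∎
  where open ≤-Reasoning

hits : {m n : ℕ} → ℕ → (Fin m → Fin n) → Bool
hits k φ = anyᶠ (λ x → does (toℕ (φ x) ℕ.≟ k))

count-hits : (m n k : ℕ) → count (hits k) (allMaps m n) * n ≤ m * n ^ m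
count-hits m n k = count-anyᶠ-≤ m _ (allMaps m n) n (n ^ m) λ x → begin
  count (λ φ → does (toℕ (φ x) ℕ.≟ k)) (allMaps m n) * n
    ≡⟨ count-allMaps-at m n x (λ c → does (toℕ c ℕ.≟ k)) ⟩
  n ^ m * count (λ c → does (toℕ c ℕ.≟ k)) (allFin n)
    ≤⟨ *-monoʳ-≤ (n ^ m) (count-toℕ-≡-≤1 n k) ⟩
  n ^ m * 1  ≡⟨ *-identityʳ (n ^ m) ⟩
  n ^ m      ∎
  where open ≤-Reasoning

∈-allPairs : {n : ℕ} (x y : Fin n) → (x , y) ∈ allPairs n
∈-allPairs {n} x y = ∈-concatMap⁺ (λ a → map (a ,_) (allFin n)) (Any.map (λ { refl → ∈-map⁺ (x ,_) (∈-allFin y) }) (∈-allFin x))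

isHom-sound : (D : Digraph) {n : ℕ} (T : Tournament n) {φ : Fin (v D) → Fin n} →
  isHom D T φ ≡ true → ∀ x y → E D x y ≡ true → adj T (φ x) (φ y) ≡ true
isHom-sound D T {φ} hom x y exy
  with All.lookup (all⁺ _ (allPairs (v D)) (Equivalence.from T-≡ hom)) (∈-allPairs x y)
... | holds rewrite exy = Equivalence.to T-≡ holds

isHom-complete : (D : Digraph) {n : ℕ} (T : Tournament n) (φ : Fin (v D) → Fin n) →
  (∀ x y → E D x y ≡ true → adj T (φ x) (φ y) ≡ true) → isHom D T φ ≡ true
isHom-complete D T φ preserves =
  Equivalence.to T-≡ (all⁻ _ (All.universal (λ { (x , y) → edge x y }) (allPairs (v D))))
  where
  edge : ∀ x y → Bool.T (if E D x y then adj T (φ x) (φ y) else true)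
  edge x y with E D x y in exy
  ... | true  = Equivalence.from T-≡ (preserves x y exy)
  ... | false = _

before : {n : ℕ} → Fin n → Fin n → Bool
before c d = does (c FinP.<? d)

before⇒< : {n : ℕ} {c d : Fin n} → before c d ≡ true → c Fin.< d
before⇒< {c = c} {d} = does-true⇒ (c FinP.<? d)

<⇒before : {n : ℕ} {c d : Fin n} → c Fin.< d → before c d ≡ true
<⇒before {c = c} {d} = dec-true (c FinP.<? d)

indexOrder : (n : ℕ) → Tournament n
indexOrder n = record
  { adj      = before
  ; loopless = λ c → dec-false (c FinP.<? c) (FinP.<-irrefl refl)
  ; oriented = λ c d c<d → dec-false (d FinP.<? c) (FinP.<-asym (before⇒< c<d))
  ; complete = trichotomy
  }
  where
  trichotomy : ∀ c d → c ≢ d → before c d ≡ true ⊎ before d c ≡ true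
  trichotomy c d c≢d with FinP.<-cmp c d
  ... | tri< c<d _ _ = inj₁ (<⇒before c<d)
  ... | tri≈ _ c≡d _ = ⊥-elim (c≢d c≡d)
  ... | tri> _ _ d<c = inj₂ (<⇒before d<c)

glue : {n : ℕ} (s : Fin n → Fin n → Bool) → (∀ c d → s c d ≡ s d c) →
  (T₁ : Tournament n) (R : Fin n → Fin n → Bool) →
  (∀ c → R c c ≡ false) → (∀ c d → R c d ≡ true → R d c ≡ false) →
  (∀ c d → s c d ≡ false → c ≢ d → R c d ≡ true ⊎ R d c ≡ true) → Tournament n
glue s s-sym T₁ R R-loopless R-oriented R-complete = record
  { adj      = glued
  ; loopless = loopless′
  ; oriented = oriented′
  ; complete = complete′
  }
  where
  glued : _ → _ → Bool
  glued c d = if s c d then adj T₁ c d else R c d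

  loopless′ : ∀ c → glued c c ≡ false
  loopless′ c with s c c
  ... | true  = Tournament.loopless T₁ c
  ... | false = R-loopless c

  oriented′ : ∀ c d → glued c d ≡ true → glued d c ≡ false
  oriented′ c d h rewrite s-sym d c with s c d
  ... | true  = Tournament.oriented T₁ c d h
  ... | false = R-oriented c d h

  complete′ : ∀ c d → c ≢ d → glued c d ≡ true ⊎ glued d c ≡ true
  complete′ c d c≢d rewrite s-sym d c with s c d in selected
  ... | true  = Tournament.complete T₁ c d c≢d
  ... | false = R-complete c d selected c≢d

completion : (D : Digraph) → Tournament (v D)
completion D = glue nonAdjacent (λ x y → cong not (∨-comm (E D x y) (E D y x)))
  (indexOrder (v D)) (E D) (loopless D) (oriented D)
  (λ x y adjacent _ → ∨-true⁻ _ _ (not-injective adjacent))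
  where
  nonAdjacent : Fin (v D) → Fin (v D) → Bool
  nonAdjacent x y = not (E D x y ∨ E D y x)

completion-⊇ : (D : Digraph) {x y : Fin (v D)} → E D x y ≡ true → adj (completion D) x y ≡ true
completion-⊇ D exy rewrite exy = refl

bothBelow : {n : ℕ} → ℕ → Fin n → Fin n → Bool
bothBelow k c d = does (toℕ c ℕ.<? k) ∧ does (toℕ d ℕ.<? k)

orderPrefix : {n : ℕ} → ℕ → Tournament n → Tournament n
orderPrefix {n} k R = glue (bothBelow k) (λ c d → ∧-comm (does (toℕ c ℕ.<? k)) _) (indexOrder n) (adj R)
  (Tournament.loopless R) (Tournament.oriented R) (λ c d _ → Tournament.complete R c d)

orderPrefix-all : {n : ℕ} (R : Tournament n) (c d : Fin n) → adj (orderPrefix n R) c d ≡ before c d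
orderPrefix-all {n} R c d
  rewrite dec-true (toℕ c ℕ.<? n) (FinP.toℕ<n c) | dec-true (toℕ d ℕ.<? n) (FinP.toℕ<n d) = refl

does-<?-suc : ∀ {m k} → m ≢ k → does (m ℕ.<? k) ≡ does (m ℕ.<? suc k)
does-<?-suc {m} {k} m≢k with <-cmp m k
... | tri< m<k _ _ = trans (dec-true (m ℕ.<? k) m<k) (sym (dec-true (m ℕ.<? suc k) (m<n⇒m<1+n m<k)))
... | tri≈ _ m≡k _ = ⊥-elim (m≢k m≡k)
... | tri> _ _ k<m = trans (dec-false (m ℕ.<? k) (<⇒≯ k<m)) (sym (dec-false (m ℕ.<? suc k) (≤⇒≯ k<m)))

orderPrefix-suc : {n : ℕ} (k : ℕ) (R : Tournament n) (c d : Fin n) → toℕ c ≢ k → toℕ d ≢ k →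
  adj (orderPrefix k R) c d ≡ adj (orderPrefix (suc k) R) c d
orderPrefix-suc k R c d c≢k d≢k rewrite does-<?-suc c≢k | does-<?-suc d≢k = refl

orderPrefix-forward : {n : ℕ} (k : ℕ) (R : Tournament n) {c d : Fin n} → c Fin.< d →
  adj R c d ≡ true → adj (orderPrefix k R) c d ≡ true
orderPrefix-forward k R {c} {d} c<d cd with bothBelow k c d
... | true  = <⇒before c<d
... | false = cd

isHom-orderPrefix-suc : (D : Digraph) {n : ℕ} (k : ℕ) (R : Tournament n) (φ : Fin (v D) → Fin n) →
  isHom D (orderPrefix k R) φ ≡ true → isHom D (orderPrefix (suc k) R) φ ≡ true ⊎ hits k φ ≡ true
isHom-orderPrefix-suc D k R φ hom with hits k φ in hit
... | true  = inj₂ refl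
... | false = inj₁ (isHom-complete D (orderPrefix (suc k) R) φ λ x y exy →
  trans (sym (orderPrefix-suc k R (φ x) (φ y) (misses x) (misses y))) (isHom-sound D (orderPrefix k R) hom x y exy))
  where
  misses : ∀ x → toℕ (φ x) ≢ k
  misses x = does-false⇒ (toℕ (φ x) ℕ.≟ k) (anyᶠ-false _ hit x)

homCount-orderPrefix-suc : (D : Digraph) {n : ℕ} (k : ℕ) (R : Tournament n) →
  homCount D (orderPrefix k R) * n ≤ homCount D (orderPrefix (suc k) R) * n + v D * n ^ v D
homCount-orderPrefix-suc D {n} k R = begin
  homCount D (orderPrefix k R) * n
    ≤⟨ *-monoˡ-≤ n (count-∨-≤ _ _ _ (isHom-orderPrefix-suc D k R) (allMaps (v D) n)) ⟩
  (homCount D (orderPrefix (suc k) R) + count (hits k) (allMaps (v D) n)) * n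
    ≡⟨ *-distribʳ-+ n (homCount D (orderPrefix (suc k) R)) _ ⟩
  homCount D (orderPrefix (suc k) R) * n + count (hits k) (allMaps (v D) n) * n
    ≤⟨ +-monoʳ-≤ _ (count-hits (v D) n k) ⟩
  homCount D (orderPrefix (suc k) R) * n + v D * n ^ v D ∎
  where open ≤-Reasoning

homCount-triangle-acyclic : (D : Digraph) {a b c : Fin (v D)} →
  E D a b ≡ true → E D b c ≡ true → E D c a ≡ true →
  {n : ℕ} (T : Tournament n) → (∀ x y → adj T x y ≡ true → x Fin.< y) → homCount D T ≡ 0
homCount-triangle-acyclic D {a} {b} {c} ab bc ca {n} T ascending = count-none _ noHom (allMaps (v D) n)
  where
  noHom : ∀ φ → isHom D T φ ≡ false
  noHom φ with isHom D T φ in hom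
  ... | false = refl
  ... | true  = ⊥-elim (FinP.<-irrefl refl (FinP.<-trans (up ab) (FinP.<-trans (up bc) (up ca))))
    where
    up : ∀ {x y} → E D x y ≡ true → φ x Fin.< φ y
    up {x} {y} exy = ascending (φ x) (φ y) (isHom-sound D T hom x y exy)

-- Blow-ups

quotient-unique : ∀ {m q d} .{{_ : ℕ.NonZero d}} → q * d ≤ m → m ℕ.< q * d + d → m / d ≡ q
quotient-unique {m} {q} {d} lower upper = ≤-antisym
  (≤-pred (m<n*o⇒m/o<n (subst (m ℕ.<_) (+-comm (q * d) d) upper)))
  (subst (_≤ m / d) (m*n/n≡m q d) (/-monoˡ-≤ d lower))

does-≟-comm : {n : ℕ} (x y : Fin n) → does (x FinP.≟ y) ≡ does (y FinP.≟ x)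
does-≟-comm x y with x FinP.≟ y
... | yes x≡y = sym (dec-true (y FinP.≟ x) (sym x≡y))
... | no  x≢y = sym (dec-false (y FinP.≟ x) (x≢y ∘ sym))

module Blocks (V : ℕ) .{{_ : ℕ.NonZero V}} where

  -- n / V, raised to 1 when n < V so that it can be divided by
  width : ℕ → ℕ
  width n = suc (ℕ.pred (n / V))

  -- V consecutive blocks of width n / V; the leftover vertices join the last block
  blockOf : {n : ℕ} → Fin n → Fin V
  blockOf {n} c = Fin.fromℕ< (m≤pred[n]⇒suc[m]≤n (m⊓n≤n (toℕ c / width n) (ℕ.pred V)))

  toℕ-blockOf : {n : ℕ} (c : Fin n) → toℕ (blockOf c) ≡ (toℕ c / width n) ⊓ ℕ.pred V
  toℕ-blockOf {n} c = FinP.toℕ-fromℕ< _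

  blockOf-mono : {n : ℕ} {c d : Fin n} → toℕ c ≤ toℕ d → toℕ (blockOf c) ≤ toℕ (blockOf d)
  blockOf-mono {n} {c} {d} c≤d rewrite toℕ-blockOf c | toℕ-blockOf d =
    ⊓-monoˡ-≤ (ℕ.pred V) (/-monoˡ-≤ (width n) c≤d)

  blockOf-<⇒< : {n : ℕ} {c d : Fin n} → toℕ (blockOf c) ℕ.< toℕ (blockOf d) → c Fin.< d
  blockOf-<⇒< {c = c} {d} blocks< = ≰⇒> λ d≤c → <⇒≱ blocks< (blockOf-mono d≤c)

  inBlock : {n : ℕ} → Fin V → Fin n → Bool
  inBlock x c = does (blockOf c FinP.≟ x)

  blockSize-≥ : (n : ℕ) (x : Fin V) → n / V ≤ count (inBlock x) (allFin n)
  blockSize-≥ n x = bound (n / V) refl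
    where
    bound : ∀ w → n / V ≡ w → w ≤ count (inBlock x) (allFin n)
    bound zero    _   = z≤n
    bound (suc t) n/V = count-tabulate-interval-≥ (inBlock x) id (toℕ x * suc t) (suc t) fits inside
      where
      fits : toℕ x * suc t + suc t ≤ n
      fits = begin
        toℕ x * suc t + suc t  ≡⟨ +-comm (toℕ x * suc t) (suc t) ⟩
        suc (toℕ x) * suc t    ≤⟨ *-monoˡ-≤ (suc t) (FinP.toℕ<n x) ⟩
        V * suc t              ≡⟨ cong (V *_) n/V ⟨
        V * (n / V)            ≡⟨ *-comm V (n / V) ⟩
        n / V * V              ≤⟨ m/n*n≤m n V ⟩
        n                      ∎
        where open ≤-Reasoning
      inside : ∀ i → toℕ x * suc t ≤ toℕ i → toℕ i ℕ.< toℕ x * suc t + suc t → inBlock x i ≡ true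
      inside i lower upper = dec-true (blockOf i FinP.≟ x) (FinP.toℕ-injective (begin
        toℕ (blockOf i)                      ≡⟨ toℕ-blockOf i ⟩
        (toℕ i / width n) ⊓ ℕ.pred V         ≡⟨ cong (λ w → (toℕ i / suc (ℕ.pred w)) ⊓ ℕ.pred V) n/V ⟩
        (toℕ i / suc t) ⊓ ℕ.pred V           ≡⟨ cong (_⊓ ℕ.pred V) (quotient-unique lower upper) ⟩
        toℕ x ⊓ ℕ.pred V                     ≡⟨ m≤n⇒m⊓n≡m (<⇒≤pred (FinP.toℕ<n x)) ⟩
        toℕ x                                ∎))
        where open ≡-Reasoning

  blowUp : {n : ℕ} → Tournament V → Tournament n
  blowUp {n} R = glue (λ c d → does (blockOf c FinP.≟ blockOf d)) (λ c d → does-≟-comm (blockOf c) (blockOf d))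
    (indexOrder n) (λ c d → adj R (blockOf c) (blockOf d))
    (λ c → Tournament.loopless R (blockOf c)) (λ c d → Tournament.oriented R (blockOf c) (blockOf d))
    (λ c d different _ → Tournament.complete R _ _ (does-false⇒ (blockOf c FinP.≟ blockOf d) different))

  blowUp-between : {n : ℕ} (R : Tournament V) {c d : Fin n} → blockOf c ≢ blockOf d →
    adj (blowUp R) c d ≡ adj R (blockOf c) (blockOf d)
  blowUp-between R {c} {d} different rewrite dec-false (blockOf c FinP.≟ blockOf d) different = refl

  blowUp-forward : {n : ℕ} (k : ℕ) (R : Tournament V) {i j : Fin V} → toℕ i ℕ.< toℕ j →
    adj R i j ≡ true → {c d : Fin n} → blockOf c ≡ i → blockOf d ≡ j →
    adj (orderPrefix k (blowUp R)) c d ≡ true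
  blowUp-forward k R i<j edge {c} {d} refl refl = orderPrefix-forward k (blowUp R) {c} {d} (blockOf-<⇒< i<j)
    (trans (blowUp-between R {c} {d} (λ same → <-irrefl (cong toℕ same) i<j)) edge)

homCount-blowUp-≥ : (D : Digraph) .{{_ : ℕ.NonZero (v D)}} (R : Tournament (v D)) →
  (∀ x y → E D x y ≡ true → adj R x y ≡ true) →
  (n : ℕ) → (n / v D) ^ v D ≤ homCount D (Blocks.blowUp (v D) {n} R)
homCount-blowUp-≥ D R D⊆R n = begin
  (n / v D) ^ v D                               ≤⟨ count-pointwise-≥ (v D) n _ inBlock (blockSize-≥ n) ⟩
  count (pointwise inBlock) (allMaps (v D) n)   ≤⟨ count-mono _ _ blockwise⇒hom (allMaps (v D) n) ⟩
  homCount D (blowUp R)                         ∎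
  where
  open Blocks (v D)
  open ≤-Reasoning
  blockwise⇒hom : ∀ φ → pointwise inBlock φ ≡ true → isHom D (blowUp R) φ ≡ true
  blockwise⇒hom φ blockwise = isHom-complete D (blowUp R) φ λ x y exy →
    trans (blowUp-between R {φ x} {φ y} (distinct exy ∘ home-injective))
          (trans (cong₂ (adj R) (home x) (home y)) (D⊆R x y exy))
    where
    home : ∀ x → blockOf (φ x) ≡ x
    home x = does-true⇒ (blockOf (φ x) FinP.≟ x) (pointwise-sound inBlock φ blockwise x)
    home-injective : ∀ {x y} → blockOf (φ x) ≡ blockOf (φ y) → x ≡ y
    home-injective {x} {y} same = trans (sym (home x)) (trans same (home y))
    distinct : ∀ {x y} → E D x y ≡ true → x ≢ y
    distinct {x} exy refl = contradiction (trans (sym (loopless D x)) exy) λ ()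

module _ {n : ℕ} (T : Tournament n) (A B : Subset n)
         (A⇒B : ∀ a b → lookup A a ≡ true → lookup B b ≡ true → adj T a b ≡ true) where

  eAB-all-≥ : count (lookup A) (allFin n) * count (lookup B) (allFin n) ≤ eAB T A B
  eAB-all-≥ = subst (_≤ eAB T A B) (count-allPairs-∧ n (lookup A) (lookup B))
    (count-mono _ _ (λ { (a , b) → edge a b }) (allPairs n))
    where
    edge : ∀ a b → lookup A a ∧ lookup B b ≡ true → lookup A a ∧ lookup B b ∧ adj T a b ≡ true
    edge a b ab with lookup A a in Aa | lookup B b in Bb
    ... | true | true rewrite A⇒B a b Aa Bb = refl

  eAB-reverse-≡0 : eAB T B A ≡ 0
  eAB-reverse-≡0 = count-none _ (λ { (b , a) → noEdge b a }) (allPairs n)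
    where
    noEdge : ∀ b a → lookup B b ∧ lookup A a ∧ adj T b a ≡ false
    noEdge b a with lookup B b in Bb | lookup A a in Aa
    ... | false | _     = refl
    ... | true  | false = refl
    ... | true  | true  = Tournament.oriented T a b (A⇒B a b Aa Bb)

bernoulli : ∀ m s → suc s ^ m * (suc s ∸ m) ≤ s ^ m * suc s
bernoulli zero    s = ≤-refl
bernoulli (suc m) s = begin
  suc s * suc s ^ m * (s ∸ m)      ≡⟨ xy∙z≈y∙xz (suc s) (suc s ^ m) (s ∸ m) ⟩
  suc s ^ m * (suc s * (s ∸ m))    ≤⟨ *-monoʳ-≤ (suc s ^ m) (one-step m) ⟩
  suc s ^ m * (s * (suc s ∸ m))    ≡⟨ x∙yz≈y∙xz (suc s ^ m) s (suc s ∸ m) ⟩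
  s * (suc s ^ m * (suc s ∸ m))    ≤⟨ *-monoʳ-≤ s (bernoulli m s) ⟩
  s * (s ^ m * suc s)              ≡⟨ *-assoc s (s ^ m) (suc s) ⟨
  s * s ^ m * suc s                ∎
  where
  open ≤-Reasoning
  one-step : ∀ m → suc s * (s ∸ m) ≤ s * (suc s ∸ m)
  one-step m with ≤-total m s
  ... | inj₁ m≤s rewrite +-∸-assoc 1 m≤s = begin
    suc s * (s ∸ m)       ≡⟨⟩
    s ∸ m + s * (s ∸ m)   ≤⟨ +-monoˡ-≤ (s * (s ∸ m)) (m∸n≤m s m) ⟩
    s + s * (s ∸ m)       ≡⟨ *-suc s (s ∸ m) ⟨
    s * suc (s ∸ m)       ∎
  ... | inj₂ s≤m rewrite m≤n⇒m∸n≡0 s≤m | *-zeroʳ (suc s) = z≤n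

m≤n*[1+m/n] : ∀ m n .{{_ : ℕ.NonZero n}} → m ≤ n * suc (m / n)
m≤n*[1+m/n] m n = begin
  m                  ≡⟨ m≡m%n+[m/n]*n m n ⟩
  m % n + m / n * n  ≤⟨ +-monoˡ-≤ (m / n * n) (<⇒≤ (m%n<n m n)) ⟩
  n + m / n * n      ≡⟨ cong (n +_) (*-comm (m / n) n) ⟩
  n + n * (m / n)    ≡⟨ *-suc n (m / n) ⟨
  n * suc (m / n)    ∎
  where open ≤-Reasoning

n*m≤o⇒m≤o/n : ∀ {m o} n .{{_ : ℕ.NonZero n}} → n * m ≤ o → m ≤ o / n
n*m≤o⇒m≤o/n {m} {o} n nm≤o = subst (_≤ o / n) (m*n/n≡m m n) (/-monoˡ-≤ n (subst (_≤ o) (*-comm n m) nm≤o))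

^-distrib-* : ∀ a b k → (a * b) ^ k ≡ a ^ k * b ^ k
^-distrib-* a b zero    = refl
^-distrib-* a b (suc k) =
  trans (cong (a * b *_) (^-distrib-* a b k)) (*-interchange a b (a ^ k) (b ^ k))

-- (1 + 1/s)^V ≤ 1 + 1/W as soon as V (W + 1) ≤ s + 1
power-ratio-≤ : ∀ V W s → V * suc W ≤ suc s → W * suc s ^ V ≤ suc W * s ^ V
power-ratio-≤ V W s large = *-cancelʳ-≤ _ _ (suc s) (begin
  W * suc s ^ V * suc s          ≡⟨ xy∙z≈y∙xz W (suc s ^ V) (suc s) ⟩
  suc s ^ V * (W * suc s)        ≤⟨ *-monoʳ-≤ (suc s ^ V) key ⟩
  suc s ^ V * (suc W * r)        ≡⟨ x∙yz≈y∙xz (suc s ^ V) (suc W) r ⟩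
  suc W * (suc s ^ V * r)        ≤⟨ *-monoʳ-≤ (suc W) (bernoulli V s) ⟩
  suc W * (s ^ V * suc s)        ≡⟨ *-assoc (suc W) (s ^ V) (suc s) ⟨
  suc W * s ^ V * suc s          ∎)
  where
  open ≤-Reasoning
  r : ℕ
  r = suc s ∸ V
  1+s≡V+r : suc s ≡ V + r
  1+s≡V+r = sym (m+[n∸m]≡n (≤-trans (m≤m*n V (suc W)) large))
  VW≤r : V * W ≤ r
  VW≤r = +-cancelˡ-≤ V _ _ (begin
    V + V * W        ≡⟨ *-suc V W ⟨
    V * suc W        ≤⟨ large ⟩
    suc s            ≡⟨ 1+s≡V+r ⟩
    V + r            ∎)
  key : W * suc s ≤ suc W * r
  key = begin
    W * suc s        ≡⟨ cong (W *_) 1+s≡V+r ⟩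
    W * (V + r)      ≡⟨ *-distribˡ-+ W V r ⟩
    W * V + W * r    ≡⟨ cong (_+ W * r) (*-comm W V) ⟩
    V * W + W * r    ≤⟨ +-monoˡ-≤ (W * r) VW≤r ⟩
    r + W * r        ∎

power-≤-blocks : ∀ V e n .{{_ : ℕ.NonZero V}} → V ^ V < 2 ^ e → V * (V * suc (V ^ V)) ≤ n →
  n ^ V ≤ 2 ^ e * (n / V) ^ V
power-≤-blocks V e n V^V<2^e large = begin
  n ^ V                          ≤⟨ ^-monoˡ-≤ V (m≤n*[1+m/n] n V) ⟩
  (V * suc (n / V)) ^ V          ≡⟨ ^-distrib-* V (suc (n / V)) V ⟩
  V ^ V * suc (n / V) ^ V        ≤⟨ power-ratio-≤ V (V ^ V) (n / V) (m≤n⇒m≤1+n (n*m≤o⇒m≤o/n V large)) ⟩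
  suc (V ^ V) * (n / V) ^ V      ≤⟨ *-monoˡ-≤ ((n / V) ^ V) V^V<2^e ⟩
  2 ^ e * (n / V) ^ V            ∎
  where open ≤-Reasoning

-- In fractions: H′ / X ≤ 1 / P, H / X ≤ H′ / X + V / n and V / n ≤ 1 / q give H / X ≤ 1 / P + 1 / q.
density-gap : ∀ {H H′ X P V n q} .{{_ : ℕ.NonZero n}} → P * H′ ≤ X → H * n ≤ H′ * n + V * X →
  V * q ≤ n → H * (q * P) ≤ (P + q) * X
density-gap {H} {H′} {X} {P} {V} {n} {q} PH′≤X step Vq≤n = *-cancelˡ-≤ n (begin
  n * (H * (q * P))                 ≡⟨ regroup₁ n H q P ⟩
  P * (H * n) * q                   ≤⟨ *-monoˡ-≤ q (*-monoʳ-≤ P step) ⟩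
  P * (H′ * n + V * X) * q          ≡⟨ regroup₂ P H′ n V X q ⟩
  P * H′ * (n * q) + P * X * (V * q) ≤⟨ +-mono-≤ (*-monoˡ-≤ (n * q) PH′≤X) (*-monoʳ-≤ (P * X) Vq≤n) ⟩
  X * (n * q) + P * X * n           ≡⟨ regroup₃ X n q P ⟩
  n * ((P + q) * X)                 ∎)
  where
  open ≤-Reasoning
  regroup₁ : ∀ n H q P → n * (H * (q * P)) ≡ P * (H * n) * q
  regroup₁ = solve-∀
  regroup₂ : ∀ P H′ n V X q → P * (H′ * n + V * X) * q ≡ P * H′ * (n * q) + P * X * (V * q)
  regroup₂ = solve-∀
  regroup₃ : ∀ X n q P → X * (n * q) + P * X * n ≡ n * ((P + q) * X)
  regroup₃ = solve-∀

-- Two blocks of width L ≥ 1 span more than a 1 / (4 V² + 1) fraction of all pairs.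
pairs-<-blocks : ∀ {n V L A} → n ≤ V * suc L → 1 ≤ L → L * L ≤ A → n * n ℕ.< A * suc (4 * (V * V))
pairs-<-blocks {n} {V} {L} {A} n≤ 1≤L L²≤A = begin-strict
  n * n                             ≤⟨ *-mono-≤ n≤2VL n≤2VL ⟩
  (2 * V * L) * (2 * V * L)         ≡⟨ square V L ⟩
  4 * (V * V) * (L * L)             ≤⟨ *-monoʳ-≤ (4 * (V * V)) L²≤A ⟩
  4 * (V * V) * A                   ≡⟨ *-comm (4 * (V * V)) A ⟩
  A * (4 * (V * V))                 <⟨ m<n+m (A * (4 * (V * V))) (≤-trans (*-mono-≤ 1≤L 1≤L) L²≤A) ⟩
  A + A * (4 * (V * V))             ≡⟨ *-suc A (4 * (V * V)) ⟨
  A * suc (4 * (V * V))             ∎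
  where
  open ≤-Reasoning
  square : ∀ V L → (2 * V * L) * (2 * V * L) ≡ 4 * (V * V) * (L * L)
  square = solve-∀
  n≤2VL : n ≤ 2 * V * L
  n≤2VL = begin
    n                 ≤⟨ n≤ ⟩
    V * suc L         ≤⟨ *-monoʳ-≤ V (+-monoˡ-≤ L 1≤L) ⟩
    V * (L + L)       ≡⟨ double V L ⟩
    2 * V * L         ∎
    where
    double : ∀ V L → V * (L + L) ≡ 2 * V * L
    double = solve-∀

module Fractions where
  open ℤ using (ℤ; +_; +[1+_])
  open ℚ using (0ℚ; mkℚ; toℚᵘ)
  open ℚᵘ using (mkℚᵘ; *≤*)

  toℚᵘ-/ : ∀ (a : ℤ) b .{{_ : ℕ.NonZero b}} → toℚᵘ (a ℚ./ b) ℚᵘ.≃ (a ℚᵘ./ b)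
  toℚᵘ-/ a (suc b) = ℚP.toℚᵘ-fromℚᵘ (mkℚᵘ a b)

  /-≤-/ : ∀ a b c d .{{_ : ℕ.NonZero b}} .{{_ : ℕ.NonZero d}} →
    a * d ≤ c * b → (+ a) ℚ./ b ℚ.≤ (+ c) ℚ./ d
  /-≤-/ a b@(suc _) c d@(suc _) ad≤cb = ℚP.toℚᵘ-cancel-≤
    (ℚᵘP.≤-respˡ-≃ (ℚᵘP.≃-sym (toℚᵘ-/ (+ a) b)) (ℚᵘP.≤-respʳ-≃ (ℚᵘP.≃-sym (toℚᵘ-/ (+ c) d))
      (*≤* (subst₂ ℤ._≤_ (ℤP.pos-* a d) (ℤP.pos-* c b) (ℤ.+≤+ ad≤cb)))))

  /-≤-/⁻¹ : ∀ a b c d .{{_ : ℕ.NonZero b}} .{{_ : ℕ.NonZero d}} →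
    (+ a) ℚ./ b ℚ.≤ (+ c) ℚ./ d → a * d ≤ c * b
  /-≤-/⁻¹ a b@(suc _) c d@(suc _) ab≤cd
    with *≤* le ← ℚᵘP.≤-respˡ-≃ (toℚᵘ-/ (+ a) b) (ℚᵘP.≤-respʳ-≃ (toℚᵘ-/ (+ c) d) (ℚP.toℚᵘ-mono-≤ ab≤cd))
    = ℤP.drop‿+≤+ (subst₂ ℤ._≤_ (sym (ℤP.pos-* a d)) (sym (ℤP.pos-* c b)) le)

  /-+-/ : ∀ a b c d .{{_ : ℕ.NonZero b}} .{{_ : ℕ.NonZero d}} →
    (+ a) ℚ./ b ℚ.+ (+ c) ℚ./ d ≡ ((+ (a * d + c * b)) ℚ./ (b * d)) {{m*n≢0 b d}}
  /-+-/ a b@(suc _) c d@(suc _) = ℚP.toℚᵘ-injective (begin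
    toℚᵘ ((+ a) ℚ./ b ℚ.+ (+ c) ℚ./ d)          ≈⟨ ℚP.toℚᵘ-homo-+ ((+ a) ℚ./ b) ((+ c) ℚ./ d) ⟩
    toℚᵘ ((+ a) ℚ./ b) ℚᵘ.+ toℚᵘ ((+ c) ℚ./ d)  ≈⟨ ℚᵘP.+-cong (toℚᵘ-/ (+ a) b) (toℚᵘ-/ (+ c) d) ⟩
    (+ a) ℚᵘ./ b ℚᵘ.+ (+ c) ℚᵘ./ d               ≡⟨ cong (λ z → mkℚᵘ z _) numerator ⟩
    (+ (a * d + c * b)) ℚᵘ./ (b * d)             ≈⟨ ℚᵘP.≃-sym (toℚᵘ-/ (+ (a * d + c * b)) (b * d)) ⟩
    toℚᵘ ((+ (a * d + c * b)) ℚ./ (b * d))       ∎)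
    where
    open ℚᵘP.≃-Reasoning
    numerator : (+ a) ℤ.* (+ d) ℤ.+ (+ c) ℤ.* (+ b) ≡ + (a * d + c * b)
    numerator = trans (cong₂ ℤ._+_ (sym (ℤP.pos-* a d)) (sym (ℤP.pos-* c b))) (sym (ℤP.pos-+ (a * d) (c * b)))

  /-*-/ : ∀ a b c d .{{_ : ℕ.NonZero b}} .{{_ : ℕ.NonZero d}} →
    ((+ a) ℚ./ b) ℚ.* ((+ c) ℚ./ d) ≡ ((+ (a * c)) ℚ./ (b * d)) {{m*n≢0 b d}}
  /-*-/ a b@(suc _) c d@(suc _) = ℚP.toℚᵘ-injective (begin
    toℚᵘ (((+ a) ℚ./ b) ℚ.* ((+ c) ℚ./ d))      ≈⟨ ℚP.toℚᵘ-homo-* ((+ a) ℚ./ b) ((+ c) ℚ./ d) ⟩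
    toℚᵘ ((+ a) ℚ./ b) ℚᵘ.* toℚᵘ ((+ c) ℚ./ d)  ≈⟨ ℚᵘP.*-cong (toℚᵘ-/ (+ a) b) (toℚᵘ-/ (+ c) d) ⟩
    ((+ a) ℚᵘ./ b) ℚᵘ.* ((+ c) ℚᵘ./ d)          ≡⟨ cong (λ z → mkℚᵘ z _) (sym (ℤP.pos-* a c)) ⟩
    (+ (a * c)) ℚᵘ./ (b * d)                     ≈⟨ ℚᵘP.≃-sym (toℚᵘ-/ (+ (a * c)) (b * d)) ⟩
    toℚᵘ ((+ (a * c)) ℚ./ (b * d))               ∎)
    where open ℚᵘP.≃-Reasoning

  p≤q+r⇒p-r≤q : ∀ {p q r} → p ℚ.≤ q ℚ.+ r → p ℚ.- r ℚ.≤ q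
  p≤q+r⇒p-r≤q {p} {q} {r} p≤q+r = ℚP.≤-trans (ℚP.+-monoˡ-≤ (ℚ.- r) p≤q+r) (ℚP.≤-reflexive (begin
    q ℚ.+ r ℚ.- r        ≡⟨ ℚP.+-assoc q r (ℚ.- r) ⟩
    q ℚ.+ (r ℚ.- r)      ≡⟨ cong (q ℚ.+_) (ℚP.+-inverseʳ r) ⟩
    q ℚ.+ 0ℚ             ≡⟨ ℚP.+-identityʳ q ⟩
    q                    ∎))
    where open ≡-Reasoning

  p≤q⇒0≤q-p : ∀ {p q} → p ℚ.≤ q → 0ℚ ℚ.≤ q ℚ.- p
  p≤q⇒0≤q-p {p} {q} p≤q = ℚP.≤-trans (ℚP.≤-reflexive (sym (ℚP.+-inverseʳ p))) (ℚP.+-monoˡ-≤ (ℚ.- p) p≤q)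

  p≤∣p∣ : ∀ p → p ℚ.≤ ℚ.∣ p ∣
  p≤∣p∣ p with ℚP.≤-total 0ℚ p
  ... | inj₁ 0≤p = ℚP.≤-reflexive (sym (ℚP.0≤p⇒∣p∣≡p 0≤p))
  ... | inj₂ p≤0 = ℚP.≤-trans p≤0 (ℚP.0≤∣p∣ p)

  1/suc-≤-positive : ∀ δ → 0ℚ ℚ.< δ → ∃ λ q → (+ 1) ℚ./ suc q ℚ.≤ δ
  1/suc-≤-positive δ@(mkℚ +[1+ p ] q _) _ =
    q , subst ((+ 1) ℚ./ suc q ℚ.≤_) (ℚP.↥p/↧p≡p δ) (/-≤-/ 1 (suc q) (suc p) (suc q) (*-monoˡ-≤ (suc q) {1} {suc p} (s≤s z≤n)))
  1/suc-≤-positive (mkℚ (+ zero)   _ _) 0<δ with () ← ℚ.positive 0<δ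
  1/suc-≤-positive (mkℚ ℤ.-[1+ _ ] _ _) 0<δ with () ← ℚ.positive 0<δ

  fraction-close : ∀ H X P q .{{X≢0 : ℕ.NonZero X}} .{{_ : ℕ.NonZero P}} → X ≤ H * P →
    H * (suc q * P) ≤ (P + suc q) * X → ℚ.∣ (+ H) ℚ./ X ℚ.- (+ 1) ℚ./ P ∣ ℚ.≤ (+ 1) ℚ./ suc q
  fraction-close H X P q {{X≢0}} X≤HP upper = ℚP.≤-trans (ℚP.≤-reflexive (ℚP.0≤p⇒∣p∣≡p (p≤q⇒0≤q-p above)))
    (p≤q+r⇒p-r≤q (subst ((+ H) ℚ./ X ℚ.≤_) (sym (/-+-/ 1 (suc q) 1 P)) below))
    where
    above : (+ 1) ℚ./ P ℚ.≤ (+ H) ℚ./ X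
    above = /-≤-/ 1 P H X (subst (_≤ H * P) (sym (*-identityˡ X)) X≤HP)
    below : (+ H) ℚ./ X ℚ.≤ ((+ (1 * P + 1 * suc q)) ℚ./ (suc q * P)) {{m*n≢0 (suc q) P}}
    below = /-≤-/ H X (1 * P + 1 * suc q) (suc q * P) {{X≢0}} {{m*n≢0 (suc q) P}}
      (subst (λ m → H * (suc q * P) ≤ m * X) (cong₂ _+_ (sym (*-identityˡ P)) (sym (*-identityˡ (suc q)))) upper)

  bias-≰ : ∀ ε A M K .{{_ : ℕ.NonZero K}} → M ℕ.< A * K → ℚ.∣ ε ℚ.- 0ℚ ∣ ℚ.≤ (+ 1) ℚ./ K →
    ¬ ((+ A) ℚ./ 1 ℚ.- (+ 0) ℚ./ 1 ℚ.≤ ε ℚ.* ((+ M) ℚ./ 1))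
  bias-≰ ε A M K M<AK ∣ε∣≤1/K bias = <⇒≱ M<AK (begin
    A * K              ≡⟨ cong (A *_) (*-identityʳ K) ⟨
    A * (K * 1)        ≤⟨ /-≤-/⁻¹ A 1 (1 * M) (K * 1) {{_}} {{m*n≢0 K 1}} A≤M/K ⟩
    1 * M * 1          ≡⟨ trans (*-identityʳ (1 * M)) (*-identityˡ M) ⟩
    M                  ∎)
    where
    open ≤-Reasoning
    ε≤1/K : ε ℚ.≤ (+ 1) ℚ./ K
    ε≤1/K = ℚP.≤-trans (p≤∣p∣ ε) (subst (λ e → ℚ.∣ e ∣ ℚ.≤ (+ 1) ℚ./ K) (ℚP.+-identityʳ ε) ∣ε∣≤1/K)
    A≤M/K : (+ A) ℚ./ 1 ℚ.≤ ((+ (1 * M)) ℚ./ (K * 1)) {{m*n≢0 K 1}}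
    A≤M/K = ℚP.≤-trans (subst (ℚ._≤ ε ℚ.* ((+ M) ℚ./ 1)) (ℚP.+-identityʳ _) bias)
      (ℚP.≤-trans (ℚP.*-monoʳ-≤-nonNeg ((+ M) ℚ./ 1) {{ℚP.normalize-nonNeg M 1}} ε≤1/K)
                  (ℚP.≤-reflexive (/-*-/ 1 K M 1)))

-- The counterexample

crossing : (f : ℕ → ℕ) (X m : ℕ) → X ≤ f 0 → f m ℕ.< X → ∃ λ k → X ≤ f k × f (suc k) ℕ.< X
crossing f X zero    X≤f0 fm<X = contradiction X≤f0 (<⇒≱ fm<X)
crossing f X (suc m) X≤f0 fm<X with X ≤? f m
... | yes X≤fm = m , X≤fm , fm<X
... | no  X≰fm = crossing f X m X≤f0 (≰⇒> X≰fm)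

triangle-ascending : (D : Digraph) {a b c : Fin (v D)} → E D a b ≡ true → E D b c ≡ true → E D c a ≡ true →
  Σ (Fin (v D)) λ i → Σ (Fin (v D)) λ j → i Fin.< j × E D i j ≡ true
triangle-ascending D {a} {b} {c} ab bc ca with FinP.<-cmp a b | FinP.<-cmp b c
... | tri< a<b _ _ | _            = a , b , a<b , ab
... | tri≈ _ refl _ | _           = contradiction (trans (sym (loopless D a)) ab) λ ()
... | tri> _ _ b<a | tri< b<c _ _ = b , c , b<c , bc
... | tri> _ _ b<a | tri≈ _ refl _ = contradiction (trans (sym (loopless D b)) bc) λ ()
... | tri> _ _ b<a | tri> _ _ c<b = c , a , FinP.<-trans c<b b<a , ca

module Counterexample (D : Digraph) (V^V<2^e : v D ^ v D < 2 ^ numEdges D) {a b c : Fin (v D)}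
  (ab : E D a b ≡ true) (bc : E D b c ≡ true) (ca : E D c a ≡ true) where

  open ℤ using (+_)
  open Fractions

  V P : ℕ
  V = v D
  P = 2 ^ numEdges D

  instance
    V≢0 : ℕ.NonZero V
    V≢0 = ℕ.>-nonZero (≤-<-trans z≤n (FinP.toℕ<n a))

  open Blocks V

  interpolant : (n k : ℕ) → Tournament n
  interpolant n k = orderPrefix k (blowUp (completion D))

  hom : ℕ → ℕ → ℕ
  hom n k = homCount D (interpolant n k)

  threshold : ℕ
  threshold = V * (V * suc (V ^ V))

  V≤threshold : V ≤ threshold
  V≤threshold = m≤m*n V (V * suc (V ^ V)) {{m*n≢0 V (suc (V ^ V))}}

  large⇒≢0 : ∀ {n} → threshold ≤ n → ℕ.NonZero n
  large⇒≢0 large = ℕ.>-nonZero (<-≤-trans (ℕ.>-nonZero⁻¹ V) (≤-trans V≤threshold large))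

  Crossing : ℕ → ℕ → Set
  Crossing n k = n ^ V ≤ P * hom n k × P * hom n (suc k) ℕ.< n ^ V

  crossing-step : ∀ n → threshold ≤ n → ∃ (Crossing n)
  crossing-step n large = crossing (λ k → P * hom n k) (n ^ V) n start end
    where
    start : n ^ V ≤ P * hom n 0
    start = ≤-trans (power-≤-blocks V (numEdges D) n V^V<2^e large)
                    (*-monoʳ-≤ P (homCount-blowUp-≥ D (completion D) (λ x y → completion-⊇ D) n))
    end : P * hom n n ℕ.< n ^ V
    end = begin-strict
      P * hom n n  ≡⟨ cong (P *_) (homCount-triangle-acyclic D ab bc ca (interpolant n n) ascending) ⟩
      P * 0        ≡⟨ *-zeroʳ P ⟩
      0            <⟨ m^n>0 n {{large⇒≢0 large}} V ⟩
      n ^ V        ∎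
      where
      open ≤-Reasoning
      ascending : ∀ x y → adj (interpolant n n) x y ≡ true → x Fin.< y
      ascending x y xy = before⇒< (trans (sym (orderPrefix-all (blowUp (completion D)) x y)) xy)

  choice : ∀ n → Σ ℕ λ k → threshold ≤ n → Crossing n k
  choice n = choose (threshold ≤? n)
    where
    choose : Dec (threshold ≤ n) → Σ ℕ λ k → threshold ≤ n → Crossing n k
    choose (yes large) = proj₁ (crossing-step n large) , λ _ → proj₂ (crossing-step n large)
    choose (no small)  = 0 , λ large → contradiction large small

  witness : TournamentSeq
  witness n = interpolant n (proj₁ (choice n))

  witness-density : TendsTo (λ n → homDensity D (witness n)) (twoPowNeg (numEdges D))
  witness-density δ 0<δ = threshold + V * suc q , close
    where
    q : ℕ
    q = proj₁ (1/suc-≤-positive δ 0<δ)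
    close : ∀ n → threshold + V * suc q ≤ n →
      ℚ.∣ homDensity D (witness n) ℚ.- twoPowNeg (numEdges D) ∣ ℚ.≤ δ
    close zero    large = contradiction (≤-trans (m≤m+n threshold _) large) (ℕ.NonZero.nonZero ∘ large⇒≢0)
    close (suc m) large = ℚP.≤-trans
      (fraction-close (hom n k) (n ^ V) P q {{m^n≢0 n V}} {{m^n≢0 2 (numEdges D)}} lower upper)
      (proj₂ (1/suc-≤-positive δ 0<δ))
      where
      n k : ℕ
      n = suc m
      k = proj₁ (choice n)
      bounds : Crossing n k
      bounds = proj₂ (choice n) (≤-trans (m≤m+n threshold _) large)
      lower : n ^ V ≤ hom n k * P
      lower = subst (n ^ V ≤_) (*-comm P (hom n k)) (proj₁ bounds)
      upper : hom n k * (suc q * P) ≤ (P + suc q) * n ^ V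
      upper = density-gap {hom n k} {hom n (suc k)} {n ^ V} {P} {V} {n} {suc q} (<⇒≤ (proj₂ bounds))
        (homCount-orderPrefix-suc D k (blowUp (completion D))) (≤-trans (m≤n+m (V * suc q) threshold) large)

  biasScale : ℕ
  biasScale = suc (4 * (V * V))

  ascending : Σ (Fin V) λ i → Σ (Fin V) λ j → i Fin.< j × E D i j ≡ true
  ascending = triangle-ascending D ab bc ca

  i j : Fin V
  i = proj₁ ascending
  j = proj₁ (proj₂ ascending)

  i<j : i Fin.< j
  i<j = proj₁ (proj₂ (proj₂ ascending))

  ij : E D i j ≡ true
  ij = proj₂ (proj₂ (proj₂ ascending))

  witness-biased : ¬ HasQuasirandomDirection witness
  witness-biased (ε , quasirandom , ε→0) =
    bias-≰ (ε n) (eAB T Aᵢ Aⱼ) (n * n) biasScale gap (proj₂ ε-small n (m≤m+n N threshold)) biased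
    where
    ε-small = ε→0 ((+ 1) ℚ./ biasScale) (ℚP.positive⁻¹ _ {{ℚP.normalize-pos 1 biasScale}})
    N n : ℕ
    N = proj₁ ε-small
    n = N + threshold
    T : Tournament n
    T = witness n
    blockSet : Fin V → Subset n
    blockSet x = Vec.tabulate (inBlock x)
    Aᵢ Aⱼ : Subset n
    Aᵢ = blockSet i
    Aⱼ = blockSet j
    home : ∀ {x c} → lookup (blockSet x) c ≡ true → blockOf c ≡ x
    home {x} {c} c∈x = does-true⇒ (blockOf c FinP.≟ x) (trans (sym (VecP.lookup∘tabulate (inBlock x) c)) c∈x)
    forward : ∀ c d → lookup Aᵢ c ≡ true → lookup Aⱼ d ≡ true → adj T c d ≡ true
    forward c d c∈Aᵢ d∈Aⱼ =
      blowUp-forward (proj₁ (choice n)) (completion D) i<j (completion-⊇ D ij) (home c∈Aᵢ) (home d∈Aⱼ)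
    |blockSet|-≥ : ∀ x → n / V ≤ count (lookup (blockSet x)) (allFin n)
    |blockSet|-≥ x = subst (n / V ≤_) (count-cong (λ c → sym (VecP.lookup∘tabulate (inBlock x) c)) (allFin n))
      (blockSize-≥ n x)
    gap : n * n ℕ.< eAB T Aᵢ Aⱼ * biasScale
    gap = pairs-<-blocks {n} {V} {n / V} {eAB T Aᵢ Aⱼ} (m≤n*[1+m/n] n V)
      (n*m≤o⇒m≤o/n V (subst (_≤ n) (sym (*-identityʳ V)) (≤-trans V≤threshold (m≤n+m threshold N))))
      (≤-trans (*-mono-≤ (|blockSet|-≥ i) (|blockSet|-≥ j)) (eAB-all-≥ T Aᵢ Aⱼ forward))
    biased : (+ eAB T Aᵢ Aⱼ) ℚ./ 1 ℚ.- (+ 0) ℚ./ 1 ℚ.≤ ε n ℚ.* ((+ (n * n)) ℚ./ 1)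
    biased = subst (λ e → (+ eAB T Aᵢ Aⱼ) ℚ./ 1 ℚ.- (+ e) ℚ./ 1 ℚ.≤ ε n ℚ.* ((+ (n * n)) ℚ./ 1))
      (eAB-reverse-≡0 T Aᵢ Aⱼ forward) (quasirandom n Aᵢ Aⱼ)

  ¬forcing : ¬ TournamentForcing D
  ¬forcing forcing = witness-biased (proj₂ (forcing witness) witness-density)

corollary1p17 : (D : Digraph) → v D ^ v D < 2 ^ numEdges D → ¬ Transitive D →
  ¬ TournamentForcing D
corollary1p17 D V^V<2^e intransitive forcing = intransitive transitive
  where
  transitive : Transitive D
  transitive x y z xy yz (inj₁ xz) = xz
  transitive x y z xy yz (inj₂ zx) = ⊥-elim (Counterexample.¬forcing D V^V<2^e xy yz zx forcing)
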